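{- Let $(G,\sigma)$ be a connected signed graph and $k\geq 3$ an integer. (1) If $G$ is a tree, then $C(G,\sigma)=0$. (2) For a signed circuit $(C_k,\sigma)$ of length $k$: if $k\neq 5$ or $\sigma\neq \mathbf{ - }$, then $C(C_k,\sigma)=0$; and $C(C_5,\mathbf{ - })=1$.
   Context: A signed graph $(G,\sigma)$ is a finite simple graph $G$ with a map $\sigma\colon E(G)\to\{+,-\}$ ($\{\pm\}$ viewed as a multiplicative group); $\mathbf{ - }$ denotes the all-negative signature. $C_k$ denotes the circuit (cycle) of length $k$. Information dissemination (ID) process on $(G,\sigma)$: each vertex has a state in $\{A,-A,C,0\}$, initially all $0$. In step $i\geq 1$: choose a vertex $v_i$ of state $0$ (a placement vertex) and set its state to $A$. Then, simultaneously for every vertex $v$ currently in state $0$, consider its neighbours $z$ currently in state $A$ or $-A$ (states after placing $v_i$, before this step's updates); each such $z$ sends $\sigma(vz)\cdot\mathrm{state}(z)$ (with $-(-A)=A$). If $v$ has no such neighbour it stays $0$; if all sent values are equal, $v$ takes that value; if two sent values differ, $v$ gets state $C$ (confused). Vertices with state $A$, $-A$ or $C$ keep their state. Repeat until no vertex has state $0$. The value of the run is the number of vertices of final state $C$. The confusion number $C(G,\sigma)$ is the minimum value over all possible runs. -}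

module Defs where

open import Data.Nat using (ℕ; zero; suc; _+_; _≤_; _≡ᵇ_)
open import Data.Bool using (Bool; true; false; if_then_else_; _∧_; _∨_)
open import Data.Fin using (Fin; toℕ; inject₁; fromℕ; _≟_) renaming (zero to fz; suc to fs)
open import Data.List using (List; foldr; allFin)
open import Data.Maybe using (Maybe; just; nothing)
open import Data.Product using (Σ; _×_)
open import Function.Definitions using (Injective)
open import Relation.Binary.PropositionalEquality using (_≡_; _≢_)
open import Relation.Nullary using (¬_; does)

record Graph (n : ℕ) : Set where
  field
    adj : Fin n → Fin n → Bool
open Graph public

record Simple {n : ℕ} (G : Graph n) : Set where
  field
    adj-sym    : ∀ u v → adj G u v ≡ adj G v u
    adj-irrefl : ∀ v → adj G v v ≡ false

data Sgn : Set where
  pos neg : Sgn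

flipS : Sgn → Sgn
flipS pos = neg
flipS neg = pos

sameS : Sgn → Sgn → Bool
sameS pos pos = true
sameS neg neg = true
sameS _   _   = false

-- A signature assigns a sign to every unordered pair (only values on edges matter).
Signature : ℕ → Set
Signature n = Fin n → Fin n → Sgn

SymSig : {n : ℕ} → Signature n → Set
SymSig σ = ∀ u v → σ u v ≡ σ v u

AllNeg : {n : ℕ} → Graph n → Signature n → Set
AllNeg G σ = ∀ u v → adj G u v ≡ true → σ u v ≡ neg

data Walk {n : ℕ} (G : Graph n) : Fin n → Fin n → Set where
  here : ∀ {v} → Walk G v v
  step : ∀ {u w v} → adj G u w ≡ true → Walk G w v → Walk G u v

Connected : {n : ℕ} → Graph n → Set
Connected G = ∀ u v → Walk G u v

record Circuit {n : ℕ} (G : Graph n) : Set where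
  field
    m      : ℕ
    f      : Fin (suc (suc (suc m))) → Fin n
    f-inj  : Injective _≡_ _≡_ f
    f-next : ∀ (i : Fin (suc (suc m))) → adj G (f (inject₁ i)) (f (fs i)) ≡ true
    f-close : adj G (f (fromℕ (suc (suc m)))) (f fz) ≡ true

Tree : {n : ℕ} → Graph n → Set
Tree G = Connected G × ¬ Circuit G

circuitGraph : (k : ℕ) → Graph k
circuitGraph k = record { adj = λ i j →
     (suc (toℕ i) ≡ᵇ toℕ j) ∨ (suc (toℕ j) ≡ᵇ toℕ i)
   ∨ ((toℕ i ≡ᵇ 0) ∧ (suc (toℕ j) ≡ᵇ k))
   ∨ ((toℕ j ≡ᵇ 0) ∧ (suc (toℕ i) ≡ᵇ k)) }

-- States of the ID process: A, -A, C (confused), 0.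
data St : Set where
  A negA Cf O : St

send : Sgn → St → Maybe Sgn
send s A    = just s
send s negA = just (flipS s)
send s Cf   = nothing
send s O    = nothing

data Recv : Set where
  none : Recv
  one  : Sgn → Recv
  conf : Recv

combine : Recv → Maybe Sgn → Recv
combine r nothing = r
combine none (just x) = one x
combine (one y) (just x) = if sameS y x then one y else conf
combine conf (just x) = conf

fromRecv : Recv → St
fromRecv none = O
fromRecv (one pos) = A
fromRecv (one neg) = negA
fromRecv conf = Cf

received : {n : ℕ} → Graph n → Signature n → (Fin n → St) → Fin n → Recv
received {n} G σ s w =
  foldr (λ z r → if adj G w z then combine r (send (σ w z) (s z)) else r) none (allFin n)

place : {n : ℕ} → (Fin n → St) → Fin n → (Fin n → St)
place s v w = if does (w ≟ v) then A else s w

updateO : St → Recv → St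
updateO O r = fromRecv r
updateO st r = st

stepState : {n : ℕ} → Graph n → Signature n → (Fin n → St) → Fin n → (Fin n → St)
stepState G σ s v w = let s' = place s v in updateO (s' w) (received G σ s' w)

isCf : St → ℕ
isCf Cf = 1
isCf _  = 0

countC : {n : ℕ} → (Fin n → St) → ℕ
countC {n} s = foldr (λ w acc → isCf (s w) + acc) 0 (allFin n)

data RunFrom {n : ℕ} (G : Graph n) (σ : Signature n) : (Fin n → St) → ℕ → Set where
  finished : ∀ {s} → (∀ w → s w ≢ O) → RunFrom G σ s (countC s)
  placeAt  : ∀ {s c} (v : Fin n) → s v ≡ O → RunFrom G σ (stepState G σ s v) c → RunFrom G σ s c

initial : {n : ℕ} → Fin n → St
initial _ = O

IsConfusionNumber : {n : ℕ} → Graph n → Signature n → ℕ → Set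
IsConfusionNumber G σ c = RunFrom G σ initial c × (∀ c' → RunFrom G σ initial c' → c ≤ c')

-- Call a placement safe if afterwards every uninformed vertex has at most one informed
-- neighbour: then nobody receives two messages, so nobody gets confused. Hence C = 0 as soon as
-- some invariant can be maintained by safe placements until every vertex is informed.
-- In a tree, always place next to the informed set, which therefore stays connected: an
-- uninformed vertex with two informed neighbours would close a circuit through that set.
-- On C_k, place at 0 first; the uninformed vertices then form a path of r = k − 3 vertices
-- flanked by informed ones. Placing at its first vertex is safe and shrinks r by 3, and a path
-- of one vertex, or of five (placing in the middle), is completed safely in one step, so only
-- r = 2, i.e. k = 5, gets stuck. The process reads σ only on edges, so a signature of C_5 is
-- given by its five edge signs; exhaustive search over all runs for the 32 sign patterns shows
-- that only the all-negative one forces confusion, and that one confused vertex suffices.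
module Submission where

open import Defs
open import Data.Bool using (true; false; if_then_else_; _∨_; _∧_)
open import Data.Bool.Properties using (T-≡; T-∨; T-∧; ∨-zeroʳ) renaming (_≟_ to _≟ᵇ_)
open import Data.Empty using (⊥; ⊥-elim)
open import Data.Fin using (Fin; toℕ; fromℕ; fromℕ<; inject₁; inject≤; _≟_) renaming (zero to fz; suc to fs)
open import Data.Fin.Properties
  using (toℕ-injective; toℕ-inject≤; toℕ-inject₁; toℕ-fromℕ; toℕ-fromℕ<; toℕ<n; inject≤-injective; any?; all?)
  renaming (suc-injective to fs-injective)
open import Data.List using (List; []; _∷_; foldr; allFin)
open import Data.List.Membership.Propositional using (_∈_)
open import Data.List.Membership.Propositional.Properties using (∈-allFin)
open import Data.List.Relation.Unary.Any using (here; there)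
open import Data.Maybe using (just; nothing)
open import Data.Nat using (ℕ; zero; suc; pred; _+_; >-nonZero; _≤_; _<_; z≤n; s≤s; s≤s⁻¹; _≡ᵇ_)
  renaming (_≟_ to _≟ℕ_)
open import Data.Nat.Properties
  using (≤-refl; ≤-reflexive; ≤-trans; <-trans; ≤-<-trans; <-≤-trans; <-irrefl; m≤m+n; n<1+n; m≤n⇒m<n∨m≡n;
         m≤n⇒m≤1+n; +-mono-≤; +-mono-<-≤; +-mono-≤-<; +-monoʳ-<; +-monoʳ-≤; +-assoc; +-cancelˡ-≡; +-suc;
         +-identityʳ; suc-pred; suc-injective; ≡ᵇ⇒≡; ≡⇒≡ᵇ)
open import Data.Product using (Σ; ∃-syntax; _×_; _,_; proj₁; proj₂)
open import Data.Sum using (_⊎_; inj₁; inj₂; [_,_]′)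
open import Data.Vec using (Vec; []; _∷_; lookup; tabulate)
open import Data.Vec.Properties using (lookup∘tabulate)
open import Function using (_∘_; case_of_)
open import Function.Bundles using (Equivalence)
open import Function.Definitions using (Injective)
open import Relation.Binary.PropositionalEquality
  using (_≡_; _≢_; refl; sym; trans; cong; cong₂; subst; subst₂; module ≡-Reasoning)
open import Relation.Nullary using (¬_; Dec; yes; no; does; ¬?)
open import Relation.Nullary.Decidable using (map′; _×-dec_; _⊎-dec_; _→-dec_; from-yes; from-no)

data Informed : St → Set where
  A-informed    : Informed A
  negA-informed : Informed negA

Informed⇒≢O : ∀ {x} → Informed x → x ≢ O
Informed⇒≢O A-informed    ()
Informed⇒≢O negA-informed ()

informed? : (x : St) → Dec (Informed x)
informed? A    = yes A-informed
informed? negA = yes negA-informed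
informed? Cf   = no λ ()
informed? O    = no λ ()

isO? : (x : St) → Dec (x ≡ O)
isO? A    = no λ ()
isO? negA = no λ ()
isO? Cf   = no λ ()
isO? O    = yes refl

≢O⇒Informed : ∀ {x} → x ≢ O → x ≢ Cf → Informed x
≢O⇒Informed {A}    _   _    = A-informed
≢O⇒Informed {negA} _   _    = negA-informed
≢O⇒Informed {Cf}   _   x≢Cf = ⊥-elim (x≢Cf refl)
≢O⇒Informed {O}    x≢O _    = ⊥-elim (x≢O refl)

send-Informed : ∀ sg {x} → Informed x → ∃[ y ] send sg x ≡ just y
send-Informed sg A-informed    = sg , refl
send-Informed sg negA-informed = flipS sg , refl

send-¬Informed : ∀ sg {x} → ¬ Informed x → send sg x ≡ nothing
send-¬Informed sg {A}    ¬i = ⊥-elim (¬i A-informed)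
send-¬Informed sg {negA} ¬i = ⊥-elim (¬i negA-informed)
send-¬Informed sg {Cf}   _  = refl
send-¬Informed sg {O}    _  = refl

send≡just⇒Informed : ∀ sg x {y} → send sg x ≡ just y → Informed x
send≡just⇒Informed sg A    _ = A-informed
send≡just⇒Informed sg negA _ = negA-informed
send≡just⇒Informed sg Cf   ()
send≡just⇒Informed sg O    ()

combine-just≢none : ∀ r y → combine r (just y) ≢ none
combine-just≢none none    y ()
combine-just≢none (one x) y e with sameS x y
combine-just≢none (one x) y () | true
combine-just≢none (one x) y () | false
combine-just≢none conf    y ()

combine-≢none : ∀ {r} m → r ≢ none → combine r m ≢ none
combine-≢none {r} nothing  r≢none = r≢none
combine-≢none {r} (just y) _      = combine-just≢none r y

combine-unanimous : ∀ {x r m} → r ≡ none ⊎ r ≡ one x → m ≡ nothing ⊎ m ≡ just x →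
                    combine r m ≡ none ⊎ combine r m ≡ one x
combine-unanimous r-ok (inj₁ refl) = r-ok
combine-unanimous (inj₁ refl) (inj₂ refl) = inj₂ refl
combine-unanimous {pos} (inj₂ refl) (inj₂ refl) = inj₂ refl
combine-unanimous {neg} (inj₂ refl) (inj₂ refl) = inj₂ refl

updateO-settled : ∀ {st} r → st ≢ O → updateO st r ≡ st
updateO-settled {A}    _ _   = refl
updateO-settled {negA} _ _   = refl
updateO-settled {Cf}   _ _   = refl
updateO-settled {O}    _ O≢O = ⊥-elim (O≢O refl)

updateO≡O : ∀ st r → updateO st r ≡ O → st ≡ O × r ≡ none
updateO≡O O none      _ = refl , refl
updateO≡O O (one pos) ()
updateO≡O O (one neg) ()
updateO≡O O conf      ()
updateO≡O A    _ ()
updateO≡O negA _ ()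
updateO≡O Cf   _ ()

updateO≢Cf : ∀ {st} r → st ≢ Cf → (st ≡ O → r ≢ conf) → updateO st r ≢ Cf
updateO≢Cf {A}    _         _    _ ()
updateO≢Cf {negA} _         _    _ ()
updateO≢Cf {Cf}   _         ≢Cf  _ = ⊥-elim (≢Cf refl)
updateO≢Cf {O}    none      _    _ ()
updateO≢Cf {O}    (one pos) _    _ ()
updateO≢Cf {O}    (one neg) _    _ ()
updateO≢Cf {O}    conf      _    ok = ⊥-elim (ok refl refl)

NoConfusion : ∀ {n} → (Fin n → St) → Set
NoConfusion s = ∀ w → s w ≢ Cf

place-self : ∀ {n} (s : Fin n → St) v → place s v v ≡ A
place-self s v with v ≟ v
... | yes _   = refl
... | no v≢v = ⊥-elim (v≢v refl)

place-other : ∀ {n} (s : Fin n → St) {v w} → w ≢ v → place s v w ≡ s w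
place-other s {v} {w} w≢v with w ≟ v
... | yes w≡v = ⊥-elim (w≢v w≡v)
... | no _    = refl

place≡O : ∀ {n} (s : Fin n → St) {v w} → place s v w ≡ O → w ≢ v × s w ≡ O
place≡O s {v} {w} e with w ≟ v
... | no w≢v = w≢v , e

place-self-Informed : ∀ {n} (s : Fin n → St) v → Informed (place s v v)
place-self-Informed s v = subst Informed (sym (place-self s v)) A-informed

place-Informed : ∀ {n} (s : Fin n → St) {v w} → Informed (s w) → Informed (place s v w)
place-Informed s {v} {w} i with w ≟ v
... | yes _ = A-informed
... | no _  = i

place≢O : ∀ {n} (s : Fin n → St) {v w} → s w ≢ O → place s v w ≢ O
place≢O s {v} {w} s≢O with w ≟ v
... | yes _ = λ ()
... | no _  = s≢O

place-NoConfusion : ∀ {n} (s : Fin n → St) v → NoConfusion s → NoConfusion (place s v)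
place-NoConfusion s v nc w with w ≟ v
... | yes _ = λ ()
... | no _  = nc w

place-Informed⇒self : ∀ {n} (s : Fin n → St) {v z} → (∀ w → s w ≡ O) → Informed (place s v z) → z ≡ v
place-Informed⇒self s {v} {z} allO i with z ≟ v
... | yes z≡v = z≡v
... | no _    = ⊥-elim (Informed⇒≢O i (allO z))

sumOver : ∀ {n} → (Fin n → ℕ) → List (Fin n) → ℕ
sumOver f = foldr (λ w acc → f w + acc) 0

sumOver-zero : ∀ {n} {f : Fin n → ℕ} → (∀ w → f w ≡ 0) → ∀ ws → sumOver f ws ≡ 0
sumOver-zero f≡0 []       = refl
sumOver-zero f≡0 (w ∷ ws) rewrite f≡0 w = sumOver-zero f≡0 ws

sumOver-cong : ∀ {n} {f g : Fin n → ℕ} → (∀ w → f w ≡ g w) → ∀ ws → sumOver f ws ≡ sumOver g ws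
sumOver-cong f≡g []       = refl
sumOver-cong f≡g (w ∷ ws) rewrite f≡g w | sumOver-cong f≡g ws = refl

sumOver-mono-< : ∀ {n} {f g : Fin n → ℕ} {v} → (∀ w → f w ≤ g w) → f v < g v →
                 ∀ {ws} → v ∈ ws → sumOver f ws < sumOver g ws
sumOver-mono-< {f = f} {g} f≤g fv<gv {_ ∷ ws} (here refl) = +-mono-<-≤ fv<gv (mono ws)
  where
  mono : ∀ ws → sumOver f ws ≤ sumOver g ws
  mono []       = z≤n
  mono (w ∷ ws) = +-mono-≤ (f≤g w) (mono ws)
sumOver-mono-< f≤g fv<gv {w ∷ _} (there v∈ws) = +-mono-≤-< (f≤g w) (sumOver-mono-< f≤g fv<gv v∈ws)

isO : St → ℕ
isO O = 1
isO _ = 0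

isO≤1 : ∀ x → isO x ≤ 1
isO≤1 O = ≤-refl
isO≤1 A = z≤n
isO≤1 negA = z≤n
isO≤1 Cf = z≤n

isO-≢O : ∀ {x} → x ≢ O → isO x ≡ 0
isO-≢O {O} x≢O = ⊥-elim (x≢O refl)
isO-≢O {A} _ = refl
isO-≢O {negA} _ = refl
isO-≢O {Cf} _ = refl

countC≡0 : ∀ {n} (s : Fin n → St) → NoConfusion s → countC s ≡ 0
countC≡0 {n} s nc = sumOver-zero isCf≡0 (allFin n)
  where
  isCf≡0 : ∀ w → isCf (s w) ≡ 0
  isCf≡0 w with s w in e
  ... | A    = refl
  ... | negA = refl
  ... | O    = refl
  ... | Cf   = ⊥-elim (nc w e)

-- Safe placements

module Process {n : ℕ} (G : Graph n) (σ : Signature n) where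

  State : Set
  State = Fin n → St

  Informant : State → Fin n → Fin n → Set
  Informant t w z = adj G w z ≡ true × Informed (t z)

  UniqueInformant : State → Fin n → Set
  UniqueInformant t w = ∀ {z₁ z₂} → Informant t w z₁ → Informant t w z₂ → z₁ ≡ z₂

  receivedFrom : State → Fin n → List (Fin n) → Recv
  receivedFrom t w = foldr (λ z r → if adj G w z then combine r (send (σ w z) (t z)) else r) none

  receivedFrom-none : ∀ t w → (∀ z → ¬ Informant t w z) → ∀ zs → receivedFrom t w zs ≡ none
  receivedFrom-none t w uninformed []       = refl
  receivedFrom-none t w uninformed (z ∷ zs) with adj G w z in wz
  ... | false = receivedFrom-none t w uninformed zs
  ... | true rewrite send-¬Informed (σ w z) (λ i → uninformed z (wz , i)) = receivedFrom-none t w uninformed zs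

  receivedFrom≢none⇒Informant : ∀ t w zs → receivedFrom t w zs ≢ none → ∃[ z ] Informant t w z
  receivedFrom≢none⇒Informant t w []       r≢none = ⊥-elim (r≢none refl)
  receivedFrom≢none⇒Informant t w (z ∷ zs) r≢none with adj G w z in wz
  ... | false = receivedFrom≢none⇒Informant t w zs r≢none
  ... | true with send (σ w z) (t z) in sent
  ...   | just _  = z , wz , send≡just⇒Informed (σ w z) (t z) sent
  ...   | nothing = receivedFrom≢none⇒Informant t w zs r≢none

  Informant⇒receivedFrom≢none : ∀ t w {z zs} → z ∈ zs → Informant t w z → receivedFrom t w zs ≢ none
  Informant⇒receivedFrom≢none t w {z} {_ ∷ zs} (here refl) (wz , i) rewrite wz
    with send-Informed (σ w z) i
  ... | y , sent rewrite sent = combine-just≢none (receivedFrom t w zs) y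
  Informant⇒receivedFrom≢none t w {zs = z′ ∷ zs} (there z∈zs) inf with adj G w z′
  ... | true  = combine-≢none (send (σ w z′) (t z′)) (Informant⇒receivedFrom≢none t w z∈zs inf)
  ... | false = Informant⇒receivedFrom≢none t w z∈zs inf

  receivedFrom-unanimous : ∀ t w x →
                           (∀ z → adj G w z ≡ true → send (σ w z) (t z) ≡ nothing ⊎ send (σ w z) (t z) ≡ just x) →
                           ∀ zs → receivedFrom t w zs ≡ none ⊎ receivedFrom t w zs ≡ one x
  receivedFrom-unanimous t w x agrees []       = inj₁ refl
  receivedFrom-unanimous t w x agrees (z ∷ zs) with adj G w z in wz
  ... | true  = combine-unanimous (receivedFrom-unanimous t w x agrees zs) (agrees z wz)
  ... | false = receivedFrom-unanimous t w x agrees zs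

  received≢conf : ∀ t w → UniqueInformant t w → received G σ t w ≢ conf
  received≢conf t w unique r≡conf
    with receivedFrom≢none⇒Informant t w (allFin n) (λ r≡none → case trans (sym r≡conf) r≡none of λ ())
  ... | z₀ , w~z₀ , z₀-informed with send-Informed (σ w z₀) z₀-informed
  ...   | x , z₀-sends-x = notConf (receivedFrom-unanimous t w x unanimous (allFin n))
    where
    unanimous : ∀ z → adj G w z ≡ true → send (σ w z) (t z) ≡ nothing ⊎ send (σ w z) (t z) ≡ just x
    unanimous z w~z with informed? (t z)
    ... | no ¬informed = inj₁ (send-¬Informed (σ w z) ¬informed)
    ... | yes informed with unique (w~z , informed) (w~z₀ , z₀-informed)
    ...   | refl = inj₂ z₀-sends-x
    notConf : received G σ t w ≡ none ⊎ received G σ t w ≡ one x → ⊥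
    notConf (inj₁ r≡none) = case trans (sym r≡conf) r≡none of λ ()
    notConf (inj₂ r≡one)  = case trans (sym r≡conf) r≡one of λ ()

  stepState-settled : ∀ s v {w} → place s v w ≢ O → stepState G σ s v w ≡ place s v w
  stepState-settled s v p≢O = updateO-settled _ p≢O

  stepState-self : ∀ s v → stepState G σ s v v ≡ A
  stepState-self s v =
    trans (stepState-settled s v λ p≡O → case trans (sym (place-self s v)) p≡O of λ ()) (place-self s v)

  stepState≢O : ∀ s v {w} → s w ≢ O → stepState G σ s v w ≢ O
  stepState≢O s v s≢O rewrite stepState-settled s v (place≢O s s≢O) = place≢O s s≢O

  stepState≡O⇒ : ∀ s v w → stepState G σ s v w ≡ O → place s v w ≡ O × (∀ z → ¬ Informant (place s v) w z)
  stepState≡O⇒ s v w e with updateO≡O (place s v w) _ e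
  ... | p≡O , r≡none = p≡O , λ z inf → Informant⇒receivedFrom≢none (place s v) w (∈-allFin z) inf r≡none

  stepState≡O⇐ : ∀ s v w → place s v w ≡ O → (∀ z → ¬ Informant (place s v) w z) → stepState G σ s v w ≡ O
  stepState≡O⇐ s v w p≡O uninformed rewrite p≡O | receivedFrom-none (place s v) w uninformed (allFin n) = refl

  stepState-Informant : ∀ s v w → place s v w ≡ O → stepState G σ s v w ≢ O → ∃[ z ] Informant (place s v) w z
  stepState-Informant s v w p≡O step≢O =
    receivedFrom≢none⇒Informant (place s v) w (allFin n) λ r≡none → step≢O (stepState≡O⇐′ r≡none)
    where
    stepState≡O⇐′ : received G σ (place s v) w ≡ none → stepState G σ s v w ≡ O
    stepState≡O⇐′ r≡none rewrite p≡O | r≡none = refl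

  SafePlacement : State → Fin n → Set
  SafePlacement s v = ∀ w → place s v w ≡ O → UniqueInformant (place s v) w

  firstPlacement-safe : ∀ s v → (∀ w → s w ≡ O) → SafePlacement s v
  firstPlacement-safe s v allO w _ (_ , i₁) (_ , i₂) =
    trans (place-Informed⇒self s allO i₁) (sym (place-Informed⇒self s allO i₂))

  stepState-NoConfusion : ∀ s v → NoConfusion s → SafePlacement s v → NoConfusion (stepState G σ s v)
  stepState-NoConfusion s v nc safe w =
    updateO≢Cf _ (place-NoConfusion s v nc w) λ p≡O → received≢conf (place s v) w (safe w p≡O)

  countO : State → ℕ
  countO s = sumOver (λ w → isO (s w)) (allFin n)

  countO-stepState : ∀ s v → s v ≡ O → countO (stepState G σ s v) < countO s
  countO-stepState s v v≡O = sumOver-mono-< isO-mono isO-self (∈-allFin v)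
    where
    isO-mono : ∀ w → isO (stepState G σ s v w) ≤ isO (s w)
    isO-mono w with isO? (s w)
    ... | yes w≡O = subst (λ x → isO (stepState G σ s v w) ≤ isO x) (sym w≡O) (isO≤1 (stepState G σ s v w))
    ... | no w≢O rewrite isO-≢O (stepState≢O s v w≢O) = z≤n
    isO-self : isO (stepState G σ s v v) < isO (s v)
    isO-self rewrite stepState-self s v | v≡O = s≤s z≤n

  finishedWithoutConfusion : ∀ s → (∀ w → s w ≢ O) → NoConfusion s → RunFrom G σ s 0
  finishedWithoutConfusion s done nc = subst (RunFrom G σ s) (countC≡0 s nc) (finished done)

  Strategy : (State → Set) → Set
  Strategy Inv = ∀ {s} → NoConfusion s → Inv s → ∀ w → s w ≡ O →
                 ∃[ v ] s v ≡ O × SafePlacement s v × Inv (stepState G σ s v)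

  runWithoutConfusion : ∀ {Inv} → Strategy Inv → ∀ {s} → NoConfusion s → Inv s → RunFrom G σ s 0
  runWithoutConfusion {Inv} strategy {s} = go (suc (countO s)) ≤-refl
    where
    go : ∀ fuel {s} → countO s < fuel → NoConfusion s → Inv s → RunFrom G σ s 0
    go (suc fuel) {s} bound nc inv with any? (λ w → isO? (s w))
    ... | no noO = finishedWithoutConfusion s (λ w w≡O → noO (w , w≡O)) nc
    ... | yes (w , w≡O) with strategy nc inv w w≡O
    ...   | v , v≡O , safe , inv′ =
      placeAt v v≡O (go fuel (<-≤-trans (countO-stepState s v v≡O) (s≤s⁻¹ bound))
                         (stepState-NoConfusion s v nc safe) inv′)

  runFrom? : ∀ fuel s c → countO s < fuel → Dec (RunFrom G σ s c)
  runFrom? (suc fuel) s c bound with any? (λ w → isO? (s w))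
  ... | no noO =
    map′ (λ e → subst (RunFrom G σ s) e (finished λ w w≡O → noO (w , w≡O))) finalValue (countC s ≟ℕ c)
    where
    finalValue : ∀ {c} → RunFrom G σ s c → countC s ≡ c
    finalValue (finished _)      = refl
    finalValue (placeAt v v≡O _) = ⊥-elim (noO (v , v≡O))
  ... | yes (w , w≡O) = map′ (λ (v , v≡O , run) → placeAt v v≡O run) firstStep (any? placement?)
    where
    firstStep : RunFrom G σ s c → ∃[ v ] Σ (s v ≡ O) λ _ → RunFrom G σ (stepState G σ s v) c
    firstStep (finished done)     = ⊥-elim (done w w≡O)
    firstStep (placeAt v v≡O run) = v , v≡O , run
    placement? : ∀ v → Dec (Σ (s v ≡ O) λ _ → RunFrom G σ (stepState G σ s v) c)
    placement? v with isO? (s v)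
    ... | no v≢O  = no (v≢O ∘ proj₁)
    ... | yes v≡O = map′ (v≡O ,_) proj₂
                         (runFrom? fuel (stepState G σ s v) c (<-≤-trans (countO-stepState s v v≡O) (s≤s⁻¹ bound)))

  run? : ∀ s c → Dec (RunFrom G σ s c)
  run? s c = runFrom? (suc (countO s)) s c ≤-refl

-- Circuits from walks

data WalkIn {n : ℕ} (G : Graph n) (P : Fin n → Set) : Fin n → Fin n → Set where
  [_]    : ∀ {x} → P x → WalkIn G P x x
  _∷⟨_⟩_ : ∀ {x y z} → P x → adj G x y ≡ true → WalkIn G P y z → WalkIn G P x z

module _ {n : ℕ} {G : Graph n} {P : Fin n → Set} where

  WalkIn-head : ∀ {x y} → WalkIn G P x y → P x
  WalkIn-head [ px ]         = px
  WalkIn-head (px ∷⟨ _ ⟩ _) = px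

  _++ʷ_ : ∀ {x y z} → WalkIn G P x y → WalkIn G P y z → WalkIn G P x z
  [ _ ]           ++ʷ W′ = W′
  (px ∷⟨ e ⟩ W) ++ʷ W′ = px ∷⟨ e ⟩ (W ++ʷ W′)

  WalkIn-map : ∀ {Q : Fin n → Set} → (∀ {z} → P z → Q z) → ∀ {x y} → WalkIn G P x y → WalkIn G Q x y
  WalkIn-map P⊆Q [ px ]         = [ P⊆Q px ]
  WalkIn-map P⊆Q (px ∷⟨ e ⟩ W) = P⊆Q px ∷⟨ e ⟩ WalkIn-map P⊆Q W

record Path {n : ℕ} (G : Graph n) (len : ℕ) : Set where
  field
    vertex           : Fin (suc len) → Fin n
    vertex-injective : Injective _≡_ _≡_ vertex
    vertex-adjacent  : ∀ i → adj G (vertex (inject₁ i)) (vertex (fs i)) ≡ true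
open Path

module _ {n : ℕ} {G : Graph n} where

  prefix : ∀ {len} → Path G len → (i : Fin (suc len)) → Path G (toℕ i)
  prefix {len} p i = record
    { vertex           = λ j → vertex p (inject≤ j i<)
    ; vertex-injective = λ e → inject≤-injective i< i< _ _ (vertex-injective p e)
    ; vertex-adjacent  = λ j → subst (λ x → adj G (vertex p x) (vertex p (inject≤ (fs j) i<)) ≡ true)
                                     (inject₁-inject≤ j) (vertex-adjacent p (inject≤ j (s≤s⁻¹ i<)))
    }
    where
    i< : suc (toℕ i) ≤ suc len
    i< = toℕ<n i
    inject₁-inject≤ : ∀ j → inject₁ (inject≤ j (s≤s⁻¹ i<)) ≡ inject≤ (inject₁ j) i<
    inject₁-inject≤ j = toℕ-injective (begin
      toℕ (inject₁ (inject≤ j (s≤s⁻¹ i<))) ≡⟨ toℕ-inject₁ _ ⟩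
      toℕ (inject≤ j (s≤s⁻¹ i<))           ≡⟨ toℕ-inject≤ j _ ⟩
      toℕ j                                ≡⟨ toℕ-inject₁ j ⟨
      toℕ (inject₁ j)                      ≡⟨ toℕ-inject≤ (inject₁ j) i< ⟨
      toℕ (inject≤ (inject₁ j) i<)         ∎)
      where open ≡-Reasoning

  chord⇒Circuit : ∀ {len} (p : Path G (suc len)) (i : Fin len) →
                  adj G (vertex p (fs (fs i))) (vertex p fz) ≡ true → Circuit G
  chord⇒Circuit p i chord = record
    { m = toℕ i ; f = vertex q ; f-inj = vertex-injective q ; f-next = vertex-adjacent q
    ; f-close = subst (λ x → adj G (vertex p x) (vertex p fz) ≡ true) (sym last≡i) chord }
    where
    q : Path G (suc (suc (toℕ i)))
    q = prefix p (fs (fs i))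
    last≡i : inject≤ (fromℕ (toℕ (fs (fs i)))) (toℕ<n (fs (fs i))) ≡ fs (fs i)
    last≡i = toℕ-injective (trans (toℕ-inject≤ (fromℕ (toℕ (fs (fs i)))) (toℕ<n (fs (fs i)))) (toℕ-fromℕ _))

module SimpleGraph {n : ℕ} {G : Graph n} (simple : Simple G) where
  open Simple simple

  adjacent-sym : ∀ {u v} → adj G u v ≡ true → adj G v u ≡ true
  adjacent-sym {u} {v} uv = trans (adj-sym v u) uv

  adjacent⇒≢ : ∀ {u v} → adj G u v ≡ true → u ≢ v
  adjacent⇒≢ {u} uv refl with trans (sym (adj-irrefl u)) uv
  ... | ()

  WalkIn-reverse : ∀ {P x y} → WalkIn G P x y → WalkIn G P y x
  WalkIn-reverse [ px ]         = [ px ]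
  WalkIn-reverse (px ∷⟨ e ⟩ W) = WalkIn-reverse W ++ʷ (WalkIn-head W ∷⟨ adjacent-sym e ⟩ [ px ])

  cons : ∀ {len} (p : Path G len) y → (∀ i → vertex p i ≢ y) → adj G y (vertex p fz) ≡ true → Path G (suc len)
  cons p y fresh y~p₀ = record { vertex = vertex′ ; vertex-injective = injective ; vertex-adjacent = adjacent }
    where
    vertex′ : Fin (suc (suc _)) → Fin n
    vertex′ fz     = y
    vertex′ (fs i) = vertex p i
    injective : Injective _≡_ _≡_ vertex′
    injective {fz}   {fz}   _ = refl
    injective {fz}   {fs j} e = ⊥-elim (fresh j (sym e))
    injective {fs i} {fz}   e = ⊥-elim (fresh i e)
    injective {fs i} {fs j} e = cong fs (vertex-injective p e)
    adjacent : ∀ i → adj G (vertex′ (inject₁ i)) (vertex′ (fs i)) ≡ true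
    adjacent fz     = y~p₀
    adjacent (fs i) = vertex-adjacent p i

  tail : ∀ {len} → Path G (suc len) → Path G len
  tail p = record
    { vertex           = vertex p ∘ fs
    ; vertex-injective = fs-injective ∘ vertex-injective p
    ; vertex-adjacent  = vertex-adjacent p ∘ fs
    }

  module _ {P : Fin n → Set} {w a b : Fin n} (¬Pw : ¬ P w) (a≢b : a ≢ b) (w~b : adj G w b ≡ true) where

    -- Depth-first search along the walk, keeping a path whose far end is the fixed edge a–w:
    -- revisiting the previous vertex backtracks, revisiting an older one closes a circuit.
    extend : ∀ j (p : Path G (suc j)) → vertex p (fromℕ (suc j)) ≡ w → vertex p (inject₁ (fromℕ j)) ≡ a →
             ∀ {x} → x ≡ vertex p fz → WalkIn G P x b → Circuit G
    backtrack : ∀ j (p : Path G (suc j)) → vertex p (fromℕ (suc j)) ≡ w → vertex p (inject₁ (fromℕ j)) ≡ a →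
                ∀ {y} → vertex p (fs fz) ≡ y → WalkIn G P y b → Circuit G

    extend zero    p _    p₀≡a b≡p₀ [ _ ] = ⊥-elim (a≢b (trans (sym p₀≡a) (sym b≡p₀)))
    extend (suc j) p last _    b≡p₀ [ _ ] =
      chord⇒Circuit p (fromℕ j) (subst₂ (λ u v → adj G u v ≡ true) (sym last) b≡p₀ w~b)
    extend j p last second x≡p₀ (_∷⟨_⟩_ {y = y} _ x~y W) with any? (λ i → vertex p i ≟ y)
    ... | no fresh =
      extend (suc j) (cons p y (λ i e → fresh (i , e)) (adjacent-sym (subst (λ x → adj G x y ≡ true) x≡p₀ x~y)))
             last second refl W
    ... | yes (fz , p₀≡y)        = ⊥-elim (adjacent⇒≢ x~y (trans x≡p₀ p₀≡y))
    ... | yes (fs fz , p₁≡y)     = backtrack j p last second p₁≡y W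
    ... | yes (fs (fs i) , pᵢ≡y) =
      chord⇒Circuit p i (subst₂ (λ u v → adj G u v ≡ true) (sym pᵢ≡y) x≡p₀ (adjacent-sym x~y))

    backtrack zero    p last _      p₁≡y W = ⊥-elim (¬Pw (subst P (trans (sym p₁≡y) last) (WalkIn-head W)))
    backtrack (suc j) p last second p₁≡y W = extend j (tail p) last second (sym p₁≡y) W

  commonNeighbour⇒Circuit : ∀ {P w a b} → ¬ P w → a ≢ b → adj G w a ≡ true → adj G w b ≡ true →
                            WalkIn G P a b → Circuit G
  commonNeighbour⇒Circuit {P} {w} {a} ¬Pw a≢b w~a w~b W = extend ¬Pw a≢b w~b zero edge refl refl refl W
    where
    edge : Path G 1
    edge = record { vertex = vertex′ ; vertex-injective = injective ; vertex-adjacent = λ { fz → adjacent-sym w~a } }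
      where
      vertex′ : Fin 2 → Fin n
      vertex′ fz      = a
      vertex′ (fs fz) = w
      injective : Injective _≡_ _≡_ vertex′
      injective {fz}    {fz}    _ = refl
      injective {fz}    {fs fz} e = ⊥-elim (adjacent⇒≢ w~a (sym e))
      injective {fs fz} {fz}    e = ⊥-elim (adjacent⇒≢ w~a e)
      injective {fs fz} {fs fz} _ = refl

-- Trees

module TreeStrategy {n : ℕ} {G : Graph n} (σ : Signature n) (simple : Simple G) where
  open Process G σ
  open SimpleGraph simple

  Reached : State → Fin n → Set
  Reached s z = s z ≢ O

  ReachedConnected : State → Set
  ReachedConnected s = ∀ {x y} → Reached s x → Reached s y → WalkIn G (Reached s) x y

  Anchored : State → Fin n → Set
  Anchored s v = (∀ x → s x ≡ O) ⊎ (∃[ u ] Reached s u × adj G u v ≡ true)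

  anchoredVertex : Connected G → ∀ s w → s w ≡ O → ∃[ v ] s v ≡ O × Anchored s v
  anchoredVertex conn s w w≡O with any? (λ x → ¬? (isO? (s x)))
  ... | no noneReached = w , w≡O , inj₁ λ x → decided x (isO? (s x))
    where
    decided : ∀ x → Dec (s x ≡ O) → s x ≡ O
    decided x (yes x≡O) = x≡O
    decided x (no x≢O)  = ⊥-elim (noneReached (x , x≢O))
  ... | yes (x , x≢O) = frontier (conn x w) x≢O
    where
    frontier : ∀ {x} → Walk G x w → Reached s x → ∃[ v ] s v ≡ O × Anchored s v
    frontier here          x≢O = ⊥-elim (x≢O w≡O)
    frontier (step {w = y} x~y W) x≢O with isO? (s y)
    ... | yes y≡O = y , y≡O , inj₂ (_ , x≢O , x~y)
    ... | no y≢O  = frontier W y≢O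

  place-ReachedConnected : ∀ s v → ReachedConnected s → Anchored s v → ReachedConnected (place s v)
  place-ReachedConnected s v conn anchored x≢O y≢O = toV x≢O ++ʷ WalkIn-reverse (toV y≢O)
    where
    v-reached : Reached (place s v) v
    v-reached = Informed⇒≢O (place-self-Informed s v)
    viaAnchor : Anchored s v → ∀ {x} → x ≢ v → Reached (place s v) x → WalkIn G (Reached (place s v)) x v
    viaAnchor (inj₁ allO) {x} x≢v x≢O = ⊥-elim (x≢O (trans (place-other s x≢v) (allO x)))
    viaAnchor (inj₂ (u , u≢O , u~v)) x≢v x≢O =
      WalkIn-map (place≢O s) (conn (λ x≡O → x≢O (trans (place-other s x≢v) x≡O)) u≢O)
        ++ʷ (place≢O s u≢O ∷⟨ u~v ⟩ [ v-reached ])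
    toV : ∀ {x} → Reached (place s v) x → WalkIn G (Reached (place s v)) x v
    toV {x} x≢O = byCases (x ≟ v)
      where
      byCases : Dec (x ≡ v) → WalkIn G (Reached (place s v)) x v
      byCases (yes refl) = [ v-reached ]
      byCases (no x≢v)   = viaAnchor anchored x≢v x≢O

  placed⊆stepped : ∀ s v {z} → Reached (place s v) z → Reached (stepState G σ s v) z
  placed⊆stepped s v p≢O rewrite stepState-settled s v p≢O = p≢O

  stepped⇝placed : ∀ s v {x} → Reached (stepState G σ s v) x →
                   ∃[ x′ ] Reached (place s v) x′ × WalkIn G (Reached (stepState G σ s v)) x x′
  stepped⇝placed s v {x} x≢O with isO? (place s v x)
  ... | no p≢O  = x , p≢O , [ x≢O ]
  ... | yes p≡O with stepState-Informant s v x p≡O x≢O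
  ...   | z , x~z , z-informed =
    z , Informed⇒≢O z-informed , (x≢O ∷⟨ x~z ⟩ [ placed⊆stepped s v (Informed⇒≢O z-informed) ])

  stepState-ReachedConnected : ∀ s v → ReachedConnected (place s v) → ReachedConnected (stepState G σ s v)
  stepState-ReachedConnected s v conn x≢O y≢O with stepped⇝placed s v x≢O | stepped⇝placed s v y≢O
  ... | x′ , x′≢O , Wx | y′ , y′≢O , Wy =
    Wx ++ʷ (WalkIn-map (placed⊆stepped s v) (conn x′≢O y′≢O) ++ʷ WalkIn-reverse Wy)

  ReachedConnected⇒SafePlacement : ¬ Circuit G → ∀ s v → ReachedConnected (place s v) → SafePlacement s v
  ReachedConnected⇒SafePlacement acyclic s v conn w w≡O {z₁} {z₂} (w~z₁ , i₁) (w~z₂ , i₂) with z₁ ≟ z₂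
  ... | yes z₁≡z₂ = z₁≡z₂
  ... | no z₁≢z₂  = ⊥-elim (acyclic (commonNeighbour⇒Circuit (λ w≢O → w≢O w≡O) z₁≢z₂ w~z₁ w~z₂
                                       (conn (Informed⇒≢O i₁) (Informed⇒≢O i₂))))

  treeStrategy : Tree G → Strategy ReachedConnected
  treeStrategy (conn , acyclic) {s} _ reachedConnected w w≡O with anchoredVertex conn s w w≡O
  ... | v , v≡O , anchored =
    v , v≡O , ReachedConnected⇒SafePlacement acyclic s v placedConnected ,
    stepState-ReachedConnected s v placedConnected
    where
    placedConnected : ReachedConnected (place s v)
    placedConnected = place-ReachedConnected s v reachedConnected anchored

  tree-runWithoutConfusion : Tree G → RunFrom G σ initial 0
  tree-runWithoutConfusion tree = runWithoutConfusion (treeStrategy tree) (λ _ ()) λ x≢O _ → ⊥-elim (x≢O refl)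

-- The circuits C_k

data CycleAdjacent (k i j : ℕ) : Set where
  forward   : j ≡ suc i → CycleAdjacent k i j
  backward  : i ≡ suc j → CycleAdjacent k i j
  wrapTo0   : j ≡ 0 → suc i ≡ k → CycleAdjacent k i j
  wrapFrom0 : i ≡ 0 → suc j ≡ k → CycleAdjacent k i j

module _ {k : ℕ} where
  open Equivalence

  private
    ≡ᵇ-intro : ∀ {m n} → m ≡ n → (m ≡ᵇ n) ≡ true
    ≡ᵇ-intro {m} {n} e = to T-≡ (≡⇒≡ᵇ m n e)
    ∨-introˡ : ∀ {a b} → a ≡ true → a ∨ b ≡ true
    ∨-introˡ refl = refl
    ∨-introʳ : ∀ a {b} → b ≡ true → a ∨ b ≡ true
    ∨-introʳ a refl = ∨-zeroʳ a
    ∧-intro : ∀ {a b} → a ≡ true → b ≡ true → a ∧ b ≡ true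
    ∧-intro refl refl = refl

  adjacent⇒CycleAdjacent : ∀ {i j : Fin k} → adj (circuitGraph k) i j ≡ true → CycleAdjacent k (toℕ i) (toℕ j)
  adjacent⇒CycleAdjacent {i} {j} i~j with to T-∨ (from T-≡ i~j)
  ... | inj₁ t = forward (sym (≡ᵇ⇒≡ _ _ t))
  ... | inj₂ t with to T-∨ t
  ...   | inj₁ t′ = backward (sym (≡ᵇ⇒≡ _ _ t′))
  ...   | inj₂ t′ with to T-∨ t′
  ...     | inj₁ t″ = wrapFrom0 (≡ᵇ⇒≡ _ _ (proj₁ (to T-∧ t″))) (≡ᵇ⇒≡ _ _ (proj₂ (to T-∧ t″)))
  ...     | inj₂ t″ = wrapTo0 (≡ᵇ⇒≡ _ _ (proj₁ (to T-∧ t″))) (≡ᵇ⇒≡ _ _ (proj₂ (to T-∧ t″)))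

  CycleAdjacent⇒adjacent : ∀ {i j : Fin k} → CycleAdjacent k (toℕ i) (toℕ j) → adj (circuitGraph k) i j ≡ true
  CycleAdjacent⇒adjacent (forward e) = ∨-introˡ (≡ᵇ-intro (sym e))
  CycleAdjacent⇒adjacent {i} {j} (backward e) =
    ∨-introʳ (suc (toℕ i) ≡ᵇ toℕ j) (∨-introˡ (≡ᵇ-intro (sym e)))
  CycleAdjacent⇒adjacent {i} {j} (wrapFrom0 e e′) =
    ∨-introʳ (suc (toℕ i) ≡ᵇ toℕ j) (∨-introʳ (suc (toℕ j) ≡ᵇ toℕ i)
      (∨-introˡ (∧-intro (≡ᵇ-intro e) (≡ᵇ-intro e′))))
  CycleAdjacent⇒adjacent {i} {j} (wrapTo0 e e′) =
    ∨-introʳ (suc (toℕ i) ≡ᵇ toℕ j) (∨-introʳ (suc (toℕ j) ≡ᵇ toℕ i)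
      (∨-introʳ ((toℕ i ≡ᵇ 0) ∧ (suc (toℕ j) ≡ᵇ k)) (∧-intro (≡ᵇ-intro e) (≡ᵇ-intro e′))))

  interiorNeighbour : ∀ {w z : Fin k} → adj (circuitGraph k) w z ≡ true → 0 < toℕ w → suc (toℕ w) < k →
                      toℕ z ≡ suc (toℕ w) ⊎ suc (toℕ z) ≡ toℕ w
  interiorNeighbour w~z 0<w w+1<k with adjacent⇒CycleAdjacent w~z
  ... | forward e     = inj₁ e
  ... | backward e    = inj₂ (sym e)
  ... | wrapTo0 _ e   = ⊥-elim (<-irrefl e w+1<k)
  ... | wrapFrom0 e _ = ⊥-elim (<-irrefl (sym e) 0<w)

module IntervalStrategy {k : ℕ} (σ : Signature k) where
  open Process (circuitGraph k) σ

  record Interval (a r : ℕ) (s : State) : Set where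
    field
      O⇒inside : ∀ {w} → s w ≡ O → ∃[ d ] d < r × toℕ w ≡ a + d
      inside⇒O : ∀ {w : Fin k} {d} → d < r → toℕ w ≡ a + d → s w ≡ O
      0<a      : 0 < a
      a+r<k    : a + r < k

  module Placement {a r s} (nc : NoConfusion s) (I : Interval a r s) (p : ℕ) (p<r : p < r) where
    open Interval I

    v : Fin k
    v = fromℕ< (<-trans (+-monoʳ-< a p<r) a+r<k)

    toℕ-v : toℕ v ≡ a + p
    toℕ-v = toℕ-fromℕ< _

    v≡O : s v ≡ O
    v≡O = inside⇒O p<r toℕ-v

    placed stepped : State
    placed  = place s v
    stepped = stepState (circuitGraph k) σ s v

    -- the neighbour at offset d − 1 (resp. d + 1) lies in the block and is not the placed vertex
    OpenLeft OpenRight : ℕ → Set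
    OpenLeft d  = ∃[ e ] d ≡ suc e × e ≢ p
    OpenRight d = suc d < r × suc d ≢ p

    placed≡O⇒ : ∀ w → placed w ≡ O → ∃[ d ] d < r × toℕ w ≡ a + d × d ≢ p
    placed≡O⇒ w placed≡O with place≡O s placed≡O
    ... | w≢v , s≡O with O⇒inside s≡O
    ...   | d , d<r , w≡a+d = d , d<r , w≡a+d , λ { refl → w≢v (toℕ-injective (trans w≡a+d (sym toℕ-v))) }

    placed≡O⇐ : ∀ {w : Fin k} {d} → d < r → d ≢ p → toℕ w ≡ a + d → placed w ≡ O
    placed≡O⇐ d<r d≢p w≡a+d =
      trans (place-other s λ { refl → d≢p (+-cancelˡ-≡ a _ _ (trans (sym w≡a+d) toℕ-v)) }) (inside⇒O d<r w≡a+d)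

    interior : ∀ {w : Fin k} {d} → d < r → toℕ w ≡ a + d → 0 < toℕ w × suc (toℕ w) < k
    interior {d = d} d<r w≡a+d rewrite w≡a+d = ≤-trans 0<a (m≤m+n a d) , ≤-<-trans (+-monoʳ-< a d<r) a+r<k

    outside-Informed : ∀ {z} → toℕ z < a ⊎ a + r ≤ toℕ z → Informed (placed z)
    outside-Informed {z} outside = place-Informed s (≢O⇒Informed (s≢O outside) (nc z))
      where
      s≢O : toℕ z < a ⊎ a + r ≤ toℕ z → s z ≢ O
      s≢O (inj₁ z<a) s≡O with O⇒inside s≡O
      ... | d , _ , z≡a+d = <-irrefl refl (<-≤-trans z<a (subst (a ≤_) (sym z≡a+d) (m≤m+n a d)))
      s≢O (inj₂ a+r≤z) s≡O with O⇒inside s≡O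
      ... | d , d<r , z≡a+d = <-irrefl refl (<-≤-trans (subst (_< a + r) (sym z≡a+d) (+-monoʳ-< a d<r)) a+r≤z)

    neighbour-Informed⇒stepped≢O : ∀ {w z : Fin k} → adj (circuitGraph k) w z ≡ true → Informed (placed z) →
                                   stepped w ≢ O
    neighbour-Informed⇒stepped≢O {w} {z} w~z z-informed stepped≡O =
      proj₂ (stepState≡O⇒ s v w stepped≡O) z (w~z , z-informed)

    next-offset : ∀ {w : Fin k} {d} → toℕ w ≡ a + d → suc (toℕ w) ≡ a + suc d
    next-offset {d = d} w≡a+d = trans (cong suc w≡a+d) (sym (+-suc a d))

    vertexAt : ∀ {x} → x < k → Σ (Fin k) λ z → toℕ z ≡ x
    vertexAt x<k = fromℕ< x<k , toℕ-fromℕ< x<k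

    suc-pred-a : suc (pred a) ≡ a
    suc-pred-a = suc-pred a {{>-nonZero 0<a}}

    leftInformed⇒stepped≢O : ∀ {w : Fin k} {d} → toℕ w ≡ a + d → d ≡ 0 ⊎ d ≡ suc p → stepped w ≢ O
    leftInformed⇒stepped≢O w≡a+d (inj₁ refl)
      with vertexAt (<-trans (≤-reflexive suc-pred-a) (≤-<-trans (m≤m+n a r) a+r<k))
    ... | z , toℕ-z = neighbour-Informed⇒stepped≢O
      (CycleAdjacent⇒adjacent (backward (trans w≡a+d (trans (+-identityʳ a) (sym (trans (cong suc toℕ-z) suc-pred-a))))))
      (outside-Informed (inj₁ (subst (_< a) (sym toℕ-z) (≤-reflexive suc-pred-a))))
    leftInformed⇒stepped≢O w≡a+d (inj₂ refl) = neighbour-Informed⇒stepped≢O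
      (CycleAdjacent⇒adjacent (backward (trans w≡a+d (sym (next-offset toℕ-v))))) (place-self-Informed s v)

    rightInformed⇒stepped≢O : ∀ {w : Fin k} {d} → toℕ w ≡ a + d → suc d ≡ r ⊎ suc d ≡ p → stepped w ≢ O
    rightInformed⇒stepped≢O w≡a+d (inj₁ d+1≡r) with vertexAt a+r<k
    ... | z , toℕ-z = neighbour-Informed⇒stepped≢O
      (CycleAdjacent⇒adjacent (forward (trans toℕ-z (sym (trans (next-offset w≡a+d) (cong (a +_) d+1≡r))))))
      (outside-Informed (inj₂ (≤-reflexive (sym toℕ-z))))
    rightInformed⇒stepped≢O w≡a+d (inj₂ d+1≡p) = neighbour-Informed⇒stepped≢O
      (CycleAdjacent⇒adjacent (forward (trans toℕ-v (sym (trans (next-offset w≡a+d) (cong (a +_) d+1≡p))))))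
      (place-self-Informed s v)

    leftNeighbour-O : ∀ {w z : Fin k} {d} → toℕ w ≡ a + d → d < r → OpenLeft d → suc (toℕ z) ≡ toℕ w → placed z ≡ O
    leftNeighbour-O {d = d} w≡a+d d<r (e , refl , e≢p) z+1≡w =
      placed≡O⇐ (<-trans (n<1+n e) d<r) e≢p (suc-injective (trans z+1≡w (trans w≡a+d (+-suc a e))))

    rightNeighbour-O : ∀ {w z : Fin k} {d} → toℕ w ≡ a + d → OpenRight d → toℕ z ≡ suc (toℕ w) → placed z ≡ O
    rightNeighbour-O w≡a+d (d+1<r , d+1≢p) z≡w+1 = placed≡O⇐ d+1<r d+1≢p (trans z≡w+1 (next-offset w≡a+d))

    neighbour : ∀ {w z : Fin k} {d} → toℕ w ≡ a + d → d < r → adj (circuitGraph k) w z ≡ true →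
                toℕ z ≡ suc (toℕ w) ⊎ suc (toℕ z) ≡ toℕ w
    neighbour w≡a+d d<r w~z = interiorNeighbour w~z (proj₁ (interior d<r w≡a+d)) (proj₂ (interior d<r w≡a+d))

    Informant-right : ∀ {w z : Fin k} {d} → toℕ w ≡ a + d → d < r → OpenLeft d → Informant placed w z →
                      toℕ z ≡ suc (toℕ w)
    Informant-right w≡a+d d<r openL (w~z , z-informed) with neighbour w≡a+d d<r w~z
    ... | inj₁ right = right
    ... | inj₂ left  = ⊥-elim (Informed⇒≢O z-informed (leftNeighbour-O w≡a+d d<r openL left))

    Informant-left : ∀ {w z : Fin k} {d} → toℕ w ≡ a + d → d < r → OpenRight d → Informant placed w z →
                     suc (toℕ z) ≡ toℕ w
    Informant-left w≡a+d d<r openR (w~z , z-informed) with neighbour w≡a+d d<r w~z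
    ... | inj₁ right = ⊥-elim (Informed⇒≢O z-informed (rightNeighbour-O w≡a+d openR right))
    ... | inj₂ left  = left

    stepped≡O⇒offset : ∀ w → stepped w ≡ O → ∃[ d ] d < r × toℕ w ≡ a + d × d ≢ p
    stepped≡O⇒offset w stepped≡O = placed≡O⇒ w (proj₁ (stepState≡O⇒ s v w stepped≡O))

    safe : (∀ {d} → d < r → d ≢ p → OpenLeft d ⊎ OpenRight d) → SafePlacement s v
    safe oneSideOpen w placed≡O inf₁ inf₂ with placed≡O⇒ w placed≡O
    ... | d , d<r , w≡a+d , d≢p with oneSideOpen d<r d≢p
    ...   | inj₁ openL = toℕ-injective (trans (right inf₁) (sym (right inf₂)))
      where
      right : ∀ {z} → Informant placed w z → toℕ z ≡ suc (toℕ w)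
      right = Informant-right w≡a+d d<r openL
    ...   | inj₂ openR = toℕ-injective (suc-injective (trans (left inf₁) (sym (left inf₂))))
      where
      left : ∀ {z} → Informant placed w z → suc (toℕ z) ≡ toℕ w
      left = Informant-left w≡a+d d<r openR

    stepped≡O : ∀ {w : Fin k} {d} → toℕ w ≡ a + d → d < r → d ≢ p → OpenLeft d → OpenRight d → stepped w ≡ O
    stepped≡O {w} w≡a+d d<r d≢p openL openR = stepState≡O⇐ s v w (placed≡O⇐ d<r d≢p w≡a+d) λ z inf →
      Informed⇒≢O (proj₂ inf) (rightNeighbour-O w≡a+d openR (Informant-right w≡a+d d<r openL inf))

  PlacementInto : State → (State → Set) → Set
  PlacementInto s Inv = ∃[ v ] s v ≡ O × SafePlacement s v × Inv (stepState (circuitGraph k) σ s v)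

  completed : ∀ {a r s} → Interval a r s → ∀ {s′} → (∀ w → s′ w ≢ O) → Interval a 0 s′
  completed I done = record
    { O⇒inside = λ {w} s′≡O → ⊥-elim (done w s′≡O)
    ; inside⇒O = λ ()
    ; 0<a      = Interval.0<a I
    ; a+r<k    = ≤-<-trans (+-monoʳ-≤ _ z≤n) (Interval.a+r<k I)
    }

  placeSole : ∀ {a s} → NoConfusion s → Interval a 1 s → PlacementInto s (Interval a 0)
  placeSole {s = s} nc I = v , v≡O , safe oneSideOpen , completed I done
    where
    open Placement nc I 0 (s≤s z≤n)
    oneSideOpen : ∀ {d} → d < 1 → d ≢ 0 → OpenLeft d ⊎ OpenRight d
    oneSideOpen {0} _ 0≢0 = ⊥-elim (0≢0 refl)
    oneSideOpen {suc _} (s≤s ()) _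
    done : ∀ w → stepped w ≢ O
    done w stepped≡O with stepped≡O⇒offset w stepped≡O
    ... | 0     , _        , _ , 0≢0 = 0≢0 refl
    ... | suc _ , s≤s () , _ , _

  placeMiddle : ∀ {a s} → NoConfusion s → Interval a 5 s → PlacementInto s (Interval a 0)
  placeMiddle {s = s} nc I = v , v≡O , safe oneSideOpen , completed I done
    where
    open Placement nc I 2 (s≤s (s≤s (s≤s z≤n)))
    oneSideOpen : ∀ {d} → d < 5 → d ≢ 2 → OpenLeft d ⊎ OpenRight d
    oneSideOpen {0} _ _   = inj₂ (s≤s (s≤s z≤n) , λ ())
    oneSideOpen {1} _ _   = inj₁ (0 , refl , λ ())
    oneSideOpen {2} _ 2≢2 = ⊥-elim (2≢2 refl)
    oneSideOpen {3} _ _   = inj₂ (≤-refl , λ ())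
    oneSideOpen {4} _ _   = inj₁ (3 , refl , λ ())
    oneSideOpen {suc (suc (suc (suc (suc _))))} (s≤s (s≤s (s≤s (s≤s (s≤s ()))))) _
    done : ∀ w → stepped w ≢ O
    done w stepped≡O with stepped≡O⇒offset w stepped≡O
    ... | 0 , _ , w≡a+d , _   = leftInformed⇒stepped≢O w≡a+d (inj₁ refl) stepped≡O
    ... | 1 , _ , w≡a+d , _   = rightInformed⇒stepped≢O w≡a+d (inj₂ refl) stepped≡O
    ... | 2 , _ , _ , 2≢2     = 2≢2 refl
    ... | 3 , _ , w≡a+d , _   = leftInformed⇒stepped≢O w≡a+d (inj₂ refl) stepped≡O
    ... | 4 , _ , w≡a+d , _   = rightInformed⇒stepped≢O w≡a+d (inj₁ refl) stepped≡O
    ... | suc (suc (suc (suc (suc _)))) , s≤s (s≤s (s≤s (s≤s (s≤s ())))) , _ , _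

  placeFirst : ∀ {a r s} → NoConfusion s → Interval a (3 + r) s → PlacementInto s (Interval (a + 2) r)
  placeFirst {a} {r} {s} nc I = v , v≡O , safe oneSideOpen , record
    { O⇒inside = O⇒inside′ ; inside⇒O = inside⇒O′ ; 0<a = ≤-trans 0<a (m≤m+n a 2) ; a+r<k = a+2+r<k }
    where
    open Interval I
    open Placement nc I 0 (s≤s z≤n)
    oneSideOpen : ∀ {d} → d < 3 + r → d ≢ 0 → OpenLeft d ⊎ OpenRight d
    oneSideOpen {0}           _ 0≢0 = ⊥-elim (0≢0 refl)
    oneSideOpen {1}           _ _   = inj₂ (s≤s (s≤s (s≤s z≤n)) , λ ())
    oneSideOpen {suc (suc e)} _ _   = inj₁ (suc e , refl , λ ())
    O⇒inside′ : ∀ {w} → stepped w ≡ O → ∃[ d ] d < r × toℕ w ≡ a + 2 + d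
    O⇒inside′ {w} stepped≡O with stepped≡O⇒offset w stepped≡O
    ... | 0 , _ , _ , 0≢0 = ⊥-elim (0≢0 refl)
    ... | 1 , _ , w≡a+1 , _ = ⊥-elim (leftInformed⇒stepped≢O w≡a+1 (inj₂ refl) stepped≡O)
    ... | suc (suc d) , s≤s (s≤s (s≤s d≤r)) , w≡a+d , _ with m≤n⇒m<n∨m≡n d≤r
    ...   | inj₁ d<r = d , d<r , trans w≡a+d (sym (+-assoc a 2 d))
    ...   | inj₂ d≡r = ⊥-elim (rightInformed⇒stepped≢O w≡a+d (inj₁ (cong (3 +_) d≡r)) stepped≡O)
    inside⇒O′ : ∀ {w : Fin k} {d} → d < r → toℕ w ≡ a + 2 + d → stepped w ≡ O
    inside⇒O′ {d = d} d<r w≡a+2+d =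
      stepped≡O (trans w≡a+2+d (+-assoc a 2 d)) (s≤s (s≤s (m≤n⇒m≤1+n d<r))) (λ ())
                (suc d , refl , λ ()) (s≤s (s≤s (s≤s d<r)) , λ ())
    a+2+r<k : a + 2 + r < k
    a+2+r<k = ≤-<-trans (≤-reflexive (+-assoc a 2 r)) (<-trans (+-monoʳ-< a ≤-refl) a+r<k)

  Shrinking : State → Set
  Shrinking s = ∃[ a ] ∃[ r ] r ≢ 2 × Interval a r s

  shrinkingStep : ∀ {s} → NoConfusion s → Shrinking s → ∀ w → s w ≡ O → PlacementInto s Shrinking
  shrinkingStep nc (a , 0 , _ , I) w w≡O with Interval.O⇒inside I w≡O
  ... | _ , () , _
  shrinkingStep nc (a , 1 , _ , I) _ _ with placeSole nc I
  ... | v , v≡O , safe , I′ = v , v≡O , safe , a , 0 , (λ ()) , I′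
  shrinkingStep nc (a , 2 , 2≢2 , I) _ _ = ⊥-elim (2≢2 refl)
  shrinkingStep nc (a , suc (suc (suc r)) , _ , I) _ _ with r ≟ℕ 2
  ... | yes refl with placeMiddle nc I
  ...   | v , v≡O , safe , I′ = v , v≡O , safe , a , 0 , (λ ()) , I′
  shrinkingStep nc (a , suc (suc (suc r)) , _ , I) _ _ | no r≢2 with placeFirst nc I
  ...   | v , v≡O , safe , I′ = v , v≡O , safe , a + 2 , r , r≢2 , I′

module CycleStrategy (r₀ : ℕ) (σ : Signature (3 + r₀)) where
  open Process (circuitGraph (3 + r₀)) σ
  open IntervalStrategy σ

  firstPlacement : ∀ {s} → (∀ w → s w ≡ O) → Interval 2 r₀ (stepState (circuitGraph (3 + r₀)) σ s fz)
  firstPlacement {s} allO = record { O⇒inside = O⇒inside′ ; inside⇒O = inside⇒O′ ; 0<a = s≤s z≤n ; a+r<k = ≤-refl }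
    where
    neighbour-of-0 : ∀ {w} → CycleAdjacent (3 + r₀) (toℕ w) 0 → stepState (circuitGraph (3 + r₀)) σ s fz w ≢ O
    neighbour-of-0 {w} w~0 stepped≡O =
      proj₂ (stepState≡O⇒ s fz w stepped≡O) fz (CycleAdjacent⇒adjacent w~0 , place-self-Informed s fz)
    O⇒inside′ : ∀ {w} → stepState (circuitGraph (3 + r₀)) σ s fz w ≡ O → ∃[ d ] d < r₀ × toℕ w ≡ 2 + d
    O⇒inside′ {w} stepped≡O = byPosition (toℕ w) refl (toℕ<n w)
      where
      byPosition : ∀ x → toℕ w ≡ x → x < 3 + r₀ → ∃[ d ] d < r₀ × toℕ w ≡ 2 + d
      byPosition 0 w≡0 _ = ⊥-elim (proj₁ (place≡O s (proj₁ (stepState≡O⇒ s fz w stepped≡O))) (toℕ-injective w≡0))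
      byPosition 1 w≡1 _ = ⊥-elim (neighbour-of-0 (backward w≡1) stepped≡O)
      byPosition (suc (suc d)) w≡2+d (s≤s (s≤s (s≤s d≤r₀))) with m≤n⇒m<n∨m≡n d≤r₀
      ... | inj₁ d<r₀ = d , d<r₀ , w≡2+d
      ... | inj₂ d≡r₀ =
        ⊥-elim (neighbour-of-0 (wrapTo0 refl (cong suc (trans w≡2+d (cong (2 +_) d≡r₀)))) stepped≡O)
    inside⇒O′ : ∀ {w : Fin (3 + r₀)} {d} → d < r₀ → toℕ w ≡ 2 + d → stepState (circuitGraph (3 + r₀)) σ s fz w ≡ O
    inside⇒O′ {w} d<r₀ w≡2+d = stepState≡O⇐ s fz w (trans (place-other s w≢0) (allO w)) uninformed
      where
      w≢0 : w ≢ fz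
      w≢0 w≡0 with trans (sym (cong toℕ w≡0)) w≡2+d
      ... | ()
      uninformed : ∀ z → ¬ Informant (place s fz) w z
      uninformed z (w~z , z-informed) with place-Informed⇒self s allO z-informed
      ... | refl with interiorNeighbour {w = w} {z = fz} w~z (subst (0 <_) (sym w≡2+d) (s≤s z≤n))
                                          (subst (λ x → suc x < 3 + r₀) (sym w≡2+d) (s≤s (s≤s (s≤s d<r₀))))
      ...   | inj₁ ()
      ...   | inj₂ 1≡w with trans 1≡w w≡2+d
      ...     | ()

  Stage : State → Set
  Stage s = (∀ w → s w ≡ O) ⊎ Shrinking s

  cycleStrategy : r₀ ≢ 2 → Strategy Stage
  cycleStrategy r₀≢2 {s} nc (inj₁ allO) _ _ =
    fz , allO fz , firstPlacement-safe s fz allO , inj₂ (2 , r₀ , r₀≢2 , firstPlacement allO)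
  cycleStrategy r₀≢2 nc (inj₂ shrinking) w w≡O with shrinkingStep nc shrinking w w≡O
  ... | v , v≡O , safe , shrinking′ = v , v≡O , safe , inj₂ shrinking′

  cycle-runWithoutConfusion : r₀ ≢ 2 → RunFrom (circuitGraph (3 + r₀)) σ initial 0
  cycle-runWithoutConfusion r₀≢2 = runWithoutConfusion (cycleStrategy r₀≢2) (λ _ ()) (inj₁ λ _ → refl)

-- The circuit C_5

AgreeOnEdges : ∀ {n} → Graph n → Signature n → Signature n → Set
AgreeOnEdges G σ₁ σ₂ = ∀ u v → adj G u v ≡ true → σ₁ u v ≡ σ₂ u v

module _ {n : ℕ} {G : Graph n} {σ₁ σ₂ : Signature n} (agree : AgreeOnEdges G σ₁ σ₂) where

  private
    receivedFrom-cong : ∀ {s t : Fin n → St} w → (∀ z → s z ≡ t z) →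
                        ∀ zs → Process.receivedFrom G σ₁ s w zs ≡ Process.receivedFrom G σ₂ t w zs
    receivedFrom-cong w s≗t []       = refl
    receivedFrom-cong w s≗t (z ∷ zs) with adj G w z in wz
    ... | true  rewrite agree w z wz | s≗t z | receivedFrom-cong w s≗t zs = refl
    ... | false = receivedFrom-cong w s≗t zs

    place-cong : ∀ {s t : Fin n → St} v → (∀ z → s z ≡ t z) → ∀ z → place s v z ≡ place t v z
    place-cong v s≗t z with z ≟ v
    ... | yes _ = refl
    ... | no _  = s≗t z

    stepState-cong : ∀ {s t : Fin n → St} v → (∀ z → s z ≡ t z) → ∀ w → stepState G σ₁ s v w ≡ stepState G σ₂ t v w
    stepState-cong v s≗t w = cong₂ updateO (place-cong v s≗t w) (receivedFrom-cong w (place-cong v s≗t) (allFin n))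

    transport : ∀ {s t : Fin n → St} {c} → RunFrom G σ₁ s c → (∀ z → s z ≡ t z) → RunFrom G σ₂ t c
    transport {s} {t} (finished done) s≗t =
      subst (RunFrom G σ₂ t) (sumOver-cong (λ w → cong isCf (sym (s≗t w))) (allFin n))
            (finished λ w t≡O → done w (trans (s≗t w) t≡O))
    transport (placeAt v v≡O run) s≗t =
      placeAt v (trans (sym (s≗t v)) v≡O) (transport run (stepState-cong v s≗t))

  RunFrom-agreeOnEdges : ∀ {s c} → RunFrom G σ₁ s c → RunFrom G σ₂ s c
  RunFrom-agreeOnEdges run = transport run λ _ → refl

allNegative : ∀ {n} → Signature n
allNegative _ _ = neg

∀-Sgn? : {P : Sgn → Set} → (∀ x → Dec (P x)) → Dec (∀ x → P x)
∀-Sgn? P? = map′ (λ (p , q) → λ { pos → p ; neg → q }) (λ h → h pos , h neg) (P? pos ×-dec P? neg)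

∀-Vec? : ∀ m {P : Vec Sgn m → Set} → (∀ xs → Dec (P xs)) → Dec (∀ xs → P xs)
∀-Vec? zero    P? = map′ (λ { p [] → p }) (λ h → h []) (P? [])
∀-Vec? (suc m) P? =
  map′ (λ { h (x ∷ xs) → h x xs }) (λ h x xs → h (x ∷ xs)) (∀-Sgn? λ x → ∀-Vec? m λ xs → P? (x ∷ xs))

AllNeg? : ∀ {n} (G : Graph n) σ → Dec (AllNeg G σ)
AllNeg? G σ = all? λ u → all? λ v → (adj G u v ≟ᵇ true) →-dec isNeg? (σ u v)
  where
  isNeg? : (x : Sgn) → Dec (x ≡ neg)
  isNeg? pos = no λ ()
  isNeg? neg = yes refl

C₅ : Graph 5
C₅ = circuitGraph 5

next₅ : Fin 5 → Fin 5
next₅ fz                     = fs fz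
next₅ (fs fz)                = fs (fs fz)
next₅ (fs (fs fz))           = fs (fs (fs fz))
next₅ (fs (fs (fs fz)))      = fs (fs (fs (fs fz)))
next₅ (fs (fs (fs (fs fz)))) = fz

C₅-adjacent : ∀ u v → adj C₅ u v ≡ true → v ≡ next₅ u ⊎ u ≡ next₅ v
C₅-adjacent = from-yes (all? λ u → all? λ v → (adj C₅ u v ≟ᵇ true) →-dec ((v ≟ next₅ u) ⊎-dec (u ≟ next₅ v)))

edgeSigns₅ : Signature 5 → Vec Sgn 5
edgeSigns₅ σ = tabulate λ u → σ u (next₅ u)

fromEdgeSigns₅ : Vec Sgn 5 → Signature 5
fromEdgeSigns₅ signs u v = if does (v ≟ next₅ u) then lookup signs u else lookup signs v

fromEdgeSigns₅-edgeSigns₅ : ∀ σ → SymSig σ → AgreeOnEdges C₅ (fromEdgeSigns₅ (edgeSigns₅ σ)) σ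
fromEdgeSigns₅-edgeSigns₅ σ symmetric u v u~v with v ≟ next₅ u | C₅-adjacent u v u~v
... | yes refl | _        = lookup∘tabulate (λ u → σ u (next₅ u)) u
... | no v≢u+1 | inj₁ v≡u+1 = ⊥-elim (v≢u+1 v≡u+1)
... | no _     | inj₂ refl  = trans (lookup∘tabulate (λ u → σ u (next₅ u)) v) (symmetric v u)

C₅-noConfusionUnlessNegative : ∀ signs →
                               AllNeg C₅ (fromEdgeSigns₅ signs) ⊎ RunFrom C₅ (fromEdgeSigns₅ signs) initial 0
C₅-noConfusionUnlessNegative = from-yes (∀-Vec? 5 λ signs →
  AllNeg? C₅ (fromEdgeSigns₅ signs) ⊎-dec Process.run? C₅ (fromEdgeSigns₅ signs) initial 0)

C₅-negative-run : RunFrom C₅ allNegative initial 1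
C₅-negative-run = from-yes (Process.run? C₅ allNegative initial 1)

C₅-negative-confuses : ¬ RunFrom C₅ allNegative initial 0
C₅-negative-confuses = from-no (Process.run? C₅ allNegative initial 0)

C₅-noConfusion : ∀ σ → SymSig σ → ¬ AllNeg C₅ σ → RunFrom C₅ σ initial 0
C₅-noConfusion σ symmetric notNegative =
  [ (λ negative′ → ⊥-elim (notNegative λ u v u~v → trans (sym (agree u v u~v)) (negative′ u v u~v)))
  , RunFrom-agreeOnEdges agree
  ]′ (C₅-noConfusionUnlessNegative (edgeSigns₅ σ))
  where
  agree : AgreeOnEdges C₅ (fromEdgeSigns₅ (edgeSigns₅ σ)) σ
  agree = fromEdgeSigns₅-edgeSigns₅ σ symmetric

C₅-negative : ∀ σ → AllNeg C₅ σ → IsConfusionNumber C₅ σ 1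
C₅-negative σ allNeg =
  RunFrom-agreeOnEdges (λ u v u~v → sym (allNeg u v u~v)) C₅-negative-run , atLeastOne
  where
  atLeastOne : ∀ c → RunFrom C₅ σ initial c → 1 ≤ c
  atLeastOne zero    run = ⊥-elim (C₅-negative-confuses (RunFrom-agreeOnEdges allNeg run))
  atLeastOne (suc c) _   = s≤s z≤n

IsConfusionNumber-zero : ∀ {n} {G : Graph n} {σ} → RunFrom G σ initial 0 → IsConfusionNumber G σ 0
IsConfusionNumber-zero run = run , λ _ _ → z≤n

proposition2p4 :
      (∀ (n : ℕ) (G : Graph n) (σ : Signature n) → Simple G → SymSig σ →
         Tree G → IsConfusionNumber G σ 0)
    × (∀ (k : ℕ) → 3 ≤ k → (σ : Signature k) → SymSig σ →
         (k ≢ 5 ⊎ ¬ AllNeg (circuitGraph k) σ) →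
         IsConfusionNumber (circuitGraph k) σ 0)
    × (∀ (σ : Signature 5) → SymSig σ → AllNeg (circuitGraph 5) σ →
         IsConfusionNumber (circuitGraph 5) σ 1)
proposition2p4 = tree , circuit , λ σ _ → C₅-negative σ
  where
  tree : ∀ (n : ℕ) (G : Graph n) (σ : Signature n) → Simple G → SymSig σ → Tree G → IsConfusionNumber G σ 0
  tree _ _ σ simple _ isTree = IsConfusionNumber-zero (TreeStrategy.tree-runWithoutConfusion σ simple isTree)
  circuit : ∀ (k : ℕ) → 3 ≤ k → (σ : Signature k) → SymSig σ → (k ≢ 5 ⊎ ¬ AllNeg (circuitGraph k) σ) →
            IsConfusionNumber (circuitGraph k) σ 0
  circuit (suc (suc (suc r₀))) (s≤s (s≤s (s≤s z≤n))) σ symmetric exception with r₀ ≟ℕ 2 | exception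
  ... | no r₀≢2  | _                = IsConfusionNumber-zero (CycleStrategy.cycle-runWithoutConfusion r₀ σ r₀≢2)
  ... | yes refl | inj₁ 5≢5         = ⊥-elim (5≢5 refl)
  ... | yes refl | inj₂ notNegative = IsConfusionNumber-zero (C₅-noConfusion σ symmetric notNegative)
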